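{- Fix integers $m\ge 2$ and $n\ge 4$. For $s\ge 2$, let $R^{2s}$ denote the set of binary strings of length $2s$ of the form $1\omega0$ with $\omega\in D_{2s-2}$, where $D_{2s-2}$ is the set of Dyck words of length $2s-2$. For each $s$ with $2\le s\le\lfloor n/2\rfloor$ such that $|R^{2s}|\ge 2$, fix two distinct strings $T^{2s}=1u0$ and $B^{2s}=1v0$ in $R^{2s}$, and for $2\le h\le m$ let $M_{h,2s}$ be the set of all $h\times 2s$ binary matrices whose first row is $T^{2s}$, whose last row is $B^{2s}$, and whose rows $2,\dots,h-1$ are strings $A_i^{2s}\in R^{2s}$ with $A_i^{2s}\ne T^{2s}$ and $A_i^{2s}\ne B^{2s}$ (inner rows may repeat); if $|R^{2s}|=1$ set $M_{h,2s}=\emptyset$. Let $$\mathcal D_{m,n}=\bigcup_{2\le h\le m,\ 2\le s\le \lfloor n/2\rfloor} M_{h,2s}.$$ Then $\mathcal D_{m,n}$ is a non-overlapping set of matrices: no two (not necessarily distinct) matrices in $\mathcal D_{m,n}$ overlap.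
   Context: A Dyck word of length $2\ell$ is a binary string with $\ell$ letters $1$ (up steps) and $\ell$ letters $0$ (down steps) such that every prefix contains at least as many $1$'s as $0$'s; $D_0$ contains only the empty word. For an $r\times c$ matrix $M$ and $1\le i\le r$, $1\le j\le c$, the top-left (resp. top-right, bottom-left, bottom-right) $i\times j$ corner of $M$ is the submatrix formed by rows $1,\dots,i$ (resp. $1,\dots,i$; $r-i+1,\dots,r$; $r-i+1,\dots,r$) and columns $1,\dots,j$ (resp. $c-j+1,\dots,c$; $1,\dots,j$; $c-j+1,\dots,c$). Two matrices $A,B$ (possibly $A=B$) overlap if there is a nonempty matrix $P$ which is the bottom-right corner of one of them and the top-left corner of the other, or the bottom-left corner of one of them and the top-right corner of the other, excluding only the trivial case $A=B=P$. (A row string occurring merely as an inner factor of another row, not at a corner, does not constitute an overlap.) A set of matrices is non-overlapping if no two of its elements (including an element with itself) overlap. -}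

module Defs where

open import Data.Bool using (Bool; true; false)
open import Data.Nat using (ℕ; zero; suc; _+_; _*_; _∸_; _≤_)
open import Data.Nat.DivMod using (_/_)
open import Data.List using (List; []; _∷_; _++_; [_]; length; take; drop; map)
open import Data.List.Relation.Unary.All using (All)
open import Data.Product using (Σ; ∃; ∃-syntax; _×_; _,_)
open import Data.Sum using (_⊎_)
open import Relation.Binary.PropositionalEquality using (_≡_; _≢_)
open import Relation.Nullary using (¬_)

-- Binary strings: true = letter 1 (up step), false = letter 0 (down step).
BinStr : Set
BinStr = List Bool

ones : BinStr → ℕ
ones []           = 0
ones (true ∷ w)   = suc (ones w)
ones (false ∷ w)  = ones w

zeros : BinStr → ℕ
zeros []          = 0
zeros (true ∷ w)  = zeros w
zeros (false ∷ w) = suc (zeros w)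

IsDyck : BinStr → Set
IsDyck w = (ones w ≡ zeros w) × (∀ k → zeros (take k w) ≤ ones (take k w))

InR : ℕ → BinStr → Set
InR s w = ∃[ ω ] (IsDyck ω × length ω ≡ 2 * s ∸ 2 × w ≡ true ∷ ω ++ [ false ])

RHasTwo : ℕ → Set
RHasTwo s = ∃[ x ] ∃[ y ] (InR s x × InR s y × x ≢ y)

-- Matrices as lists of rows.
Matrix : Set
Matrix = List (List Bool)

nrows : Matrix → ℕ
nrows = length

ncols : Matrix → ℕ
ncols []      = 0
ncols (r ∷ _) = length r

topLeft topRight bottomLeft bottomRight : ℕ → ℕ → Matrix → Matrix
topLeft     i j M = map (take j) (take i M)
topRight    i j M = map (drop (ncols M ∸ j)) (take i M)
bottomLeft  i j M = map (take j) (drop (nrows M ∸ i) M)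
bottomRight i j M = map (drop (ncols M ∸ j)) (drop (nrows M ∸ i) M)

Overlap : Matrix → Matrix → Set
Overlap A B = ∃[ i ] ∃[ j ] ∃[ P ]
  ( 1 ≤ i × 1 ≤ j
  × i ≤ nrows A × j ≤ ncols A × i ≤ nrows B × j ≤ ncols B
  × ( (bottomRight i j A ≡ P × topLeft i j B ≡ P)
    ⊎ (bottomRight i j B ≡ P × topLeft i j A ≡ P)
    ⊎ (bottomLeft i j A ≡ P × topRight i j B ≡ P)
    ⊎ (bottomLeft i j B ≡ P × topRight i j A ≡ P))
  × ¬ (A ≡ B × B ≡ P))

NonOverlappingSet : (Matrix → Set) → Set
NonOverlappingSet S = ∀ A B → S A → S B → ¬ Overlap A B

-- M_{h,2s} for choices T, B (functions of s); empty when |R^{2s}| = 1.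
InM : (T B : ℕ → BinStr) → ℕ → ℕ → Matrix → Set
InM T B h s M = RHasTwo s × ∃[ inner ]
  ( length inner ≡ h ∸ 2
  × All (λ A → InR s A × A ≢ T s × A ≢ B s) inner
  × M ≡ T s ∷ inner ++ [ B s ])

InD : ℕ → ℕ → (T B : ℕ → BinStr) → Matrix → Set
InD m n T B M = ∃[ h ] ∃[ s ] (2 ≤ h × h ≤ m × 2 ≤ s × s ≤ n / 2 × InM T B h s M)

ValidChoice : ℕ → (T B : ℕ → BinStr) → Set
ValidChoice n T B = ∀ s → 2 ≤ s → s ≤ n / 2 → RHasTwo s →
  InR s (T s) × InR s (B s) × T s ≢ B s

-- The rows of every matrix of D_{m,n} are prime Dyck words 1ω0: each proper
-- prefix has more 1's than 0's and each proper suffix more 0's than 1's. A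
-- corner overlap makes a j-suffix of some row equal to a j-prefix of another,
-- so j is the full width of both matrices; equal widths force equal s, hence
-- the same top row T and bottom row B. At full width the overlap is a block of
-- consecutive rows ending one matrix and starting the other; since T occurs
-- only as a first row and B only as a last row, that block is both matrices.
module Submission where

open import Defs
open import Data.Nat using (ℕ; zero; suc; _+_; _*_; _∸_; _≤_; _<_; s≤s)
open import Data.Nat.Properties
open import Data.Bool using (true; false)
open import Data.List using (List; []; _∷_; _++_; [_]; length; take; drop; map)
open import Data.List.Properties using (length-++; take-all; take-[]; take++drop≡id; map-id; map-id-local)
open import Data.List.Membership.Propositional using (_∈_)
open import Data.List.Membership.Propositional.Properties using (∈-++⁺ʳ)
open import Data.List.Relation.Unary.Any using (here; there)
open import Data.List.Relation.Unary.All as All using (All; []; _∷_)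
open import Data.List.Relation.Unary.All.Properties using (take⁺; drop⁺; ++⁺)
open import Data.Product using (∃-syntax; _×_; _,_; proj₁; proj₂; swap)
open import Data.Sum using (_⊎_; inj₁; inj₂)
open import Data.Empty using (⊥-elim)
open import Function using (_∘_)
open import Relation.Binary.PropositionalEquality hiding ([_])

ones-++ : ∀ xs ys → ones (xs ++ ys) ≡ ones xs + ones ys
ones-++ []          ys = refl
ones-++ (true ∷ xs) ys = cong suc (ones-++ xs ys)
ones-++ (false ∷ xs) ys = ones-++ xs ys

zeros-++ : ∀ xs ys → zeros (xs ++ ys) ≡ zeros xs + zeros ys
zeros-++ []           ys = refl
zeros-++ (true ∷ xs)  ys = zeros-++ xs ys
zeros-++ (false ∷ xs) ys = cong suc (zeros-++ xs ys)

take-++ˡ : ∀ {A : Set} {n} (xs ys : List A) → n ≤ length xs → take n (xs ++ ys) ≡ take n xs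
take-++ˡ {n = zero}  xs       ys _         = refl
take-++ˡ {n = suc n} (x ∷ xs) ys (s≤s n≤xs) = cong (x ∷_) (take-++ˡ xs ys n≤xs)

record PrimeDyck (w : BinStr) : Set where
  field
    balanced : ones w ≡ zeros w
    rises    : ∀ {k} → 0 < k → k < length w → zeros (take k w) < ones (take k w)

open PrimeDyck

module _ {w : BinStr} (p : PrimeDyck w) where

  take-drop-balance : ∀ d →
    ones (take d w) + ones (drop d w) ≡ zeros (take d w) + zeros (drop d w)
  take-drop-balance d = begin
    ones (take d w) + ones (drop d w)   ≡⟨ ones-++ (take d w) _ ⟨
    ones (take d w ++ drop d w)         ≡⟨ cong ones (take++drop≡id d w) ⟩
    ones w                              ≡⟨ balanced p ⟩
    zeros w                             ≡⟨ cong zeros (take++drop≡id d w) ⟨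
    zeros (take d w ++ drop d w)        ≡⟨ zeros-++ (take d w) _ ⟩
    zeros (take d w) + zeros (drop d w) ∎
    where open ≡-Reasoning

  falls : ∀ {d} → 0 < d → d < length w → ones (drop d w) < zeros (drop d w)
  falls {d} 0<d d<w = +-cancelˡ-< (zeros (take d w)) _ _ (begin-strict
    zeros (take d w) + ones (drop d w)  <⟨ +-monoˡ-< (ones (drop d w)) (rises p 0<d d<w) ⟩
    ones (take d w) + ones (drop d w)   ≡⟨ take-drop-balance d ⟩
    zeros (take d w) + zeros (drop d w) ∎)
    where open ≤-Reasoning

  prefix-nonneg : ∀ {j} → 0 < j → j ≤ length w → zeros (take j w) ≤ ones (take j w)
  prefix-nonneg 0<j j≤w with m≤n⇒m<n∨m≡n j≤w
  ... | inj₁ j<w  = <⇒≤ (rises p 0<j j<w)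
  ... | inj₂ refl rewrite take-all (length w) w ≤-refl = ≤-reflexive (sym (balanced p))

  suffix-nonpos : ∀ {j} → 0 < j → j ≤ length w →
    ones (drop (length w ∸ j) w) ≤ zeros (drop (length w ∸ j) w)
  suffix-nonpos 0<j j≤w with m≤n⇒m<n∨m≡n j≤w
  ... | inj₁ j<w  = <⇒≤ (falls (m<n⇒0<n∸m j<w) (∸-monoʳ-< 0<j j≤w))
  ... | inj₂ refl rewrite n∸n≡0 (length w) = ≤-reflexive (balanced p)

suffix≡prefix⇒whole : ∀ {x y j} → PrimeDyck x → PrimeDyck y →
  0 < j → j ≤ length x → j ≤ length y →
  drop (length x ∸ j) x ≡ take j y → j ≡ length x × j ≡ length y
suffix≡prefix⇒whole {x} {y} {j} px py 0<j j≤x j≤y eq = whole-x , whole-y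
  where
  whole-x : j ≡ length x
  whole-x with m≤n⇒m<n∨m≡n j≤x
  ... | inj₂ j≡x = j≡x
  ... | inj₁ j<x = ⊥-elim (<⇒≱ (subst (λ v → ones v < zeros v) eq
                                 (falls px (m<n⇒0<n∸m j<x) (∸-monoʳ-< 0<j j≤x)))
                               (prefix-nonneg py 0<j j≤y))
  whole-y : j ≡ length y
  whole-y with m≤n⇒m<n∨m≡n j≤y
  ... | inj₂ j≡y = j≡y
  ... | inj₁ j<y = ⊥-elim (<⇒≱ (rises py 0<j j<y)
                               (subst (λ v → ones v ≤ zeros v) eq (suffix-nonpos px 0<j j≤x)))

InR⇒PrimeDyck : ∀ {s w} → InR s w → PrimeDyck w
InR⇒PrimeDyck (ω , (ω-balanced , ω-prefixes) , _ , refl) = record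
  { balanced = begin
      suc (ones (ω ++ [ false ]))   ≡⟨ cong suc (ones-++ ω _) ⟩
      suc (ones ω + 0)              ≡⟨ cong suc (+-identityʳ (ones ω)) ⟩
      suc (ones ω)                  ≡⟨ cong suc ω-balanced ⟩
      suc (zeros ω)                 ≡⟨ +-comm 1 (zeros ω) ⟩
      zeros ω + 1                   ≡⟨ zeros-++ ω _ ⟨
      zeros (ω ++ [ false ])        ∎
  ; rises = rises-ω
  }
  where
  open ≡-Reasoning
  rises-ω : ∀ {k} → 0 < k → k < length (true ∷ ω ++ [ false ]) →
    zeros (take k (true ∷ ω ++ [ false ])) < ones (take k (true ∷ ω ++ [ false ]))
  rises-ω {suc k} _ (s≤s k<)
    rewrite take-++ˡ ω [ false ] (m<1+n⇒m≤n (subst (k <_) (trans (length-++ ω) (+-comm _ 1)) k<))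
    = s≤s (ω-prefixes k)

InR-length : ∀ {s w} → 1 ≤ s → InR s w → length w ≡ 2 * s
InR-length {s} 1≤s (ω , _ , |ω| , refl) = begin
  suc (length (ω ++ [ false ])) ≡⟨ cong suc (length-++ ω) ⟩
  suc (length ω + 1)            ≡⟨ cong suc (+-comm (length ω) 1) ⟩
  2 + length ω                  ≡⟨ cong (2 +_) |ω| ⟩
  2 + (2 * s ∸ 2)               ≡⟨ m+[n∸m]≡n (*-monoʳ-≤ 2 1≤s) ⟩
  2 * s                         ∎
  where open ≡-Reasoning

PrimeDyckRows : ℕ → Matrix → Set
PrimeDyckRows c = All (λ r → PrimeDyck r × length r ≡ c)

head-map-drop-∈ : ∀ {A B : Set} (f : A → B) k (xs : List A) {z zs} →
  map f (drop k xs) ≡ z ∷ zs → ∃[ r ] (r ∈ xs × f r ≡ z)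
head-map-drop-∈ f zero    (x ∷ xs) refl = x , here refl , refl
head-map-drop-∈ f (suc k) (x ∷ xs) eq   with head-map-drop-∈ f k xs eq
... | r , r∈xs , fr≡z = r , there r∈xs , fr≡z

bottomRight≡topLeft⇒fullWidth : ∀ {c c' i j a as b bs} →
  PrimeDyckRows c (a ∷ as) → PrimeDyckRows c' (b ∷ bs) → 0 < j → j ≤ c → j ≤ c' →
  bottomRight (suc i) j (a ∷ as) ≡ topLeft (suc i) j (b ∷ bs) → j ≡ c × j ≡ c'
bottomRight≡topLeft⇒fullWidth {i = i} {a = a} {as} rowsA ((pb , refl) ∷ _) 0<j j≤c j≤c' eq
  with head-map-drop-∈ _ (nrows (a ∷ as) ∸ suc i) (a ∷ as) eq
... | r , r∈A , r-suffix with All.lookup rowsA r∈A | All.head rowsA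
... | pr , refl | _ , |a| rewrite |a|
  = suffix≡prefix⇒whole pr pb 0<j j≤c j≤c' r-suffix

bottomLeft≡topRight⇒fullWidth : ∀ {c c' i j a as b bs} →
  PrimeDyckRows c (a ∷ as) → PrimeDyckRows c' (b ∷ bs) → 0 < j → j ≤ c → j ≤ c' →
  bottomLeft (suc i) j (a ∷ as) ≡ topRight (suc i) j (b ∷ bs) → j ≡ c × j ≡ c'
bottomLeft≡topRight⇒fullWidth {i = i} {a = a} {as} rowsA ((pb , refl) ∷ _) 0<j j≤c j≤c' eq
  with head-map-drop-∈ _ (nrows (a ∷ as) ∸ suc i) (a ∷ as) eq
... | r , r∈A , r-prefix with All.lookup rowsA r∈A
... | pr , refl = swap (suffix≡prefix⇒whole pb pr 0<j j≤c' j≤c (sym r-prefix))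

CornersMeet : ℕ → ℕ → Matrix → Matrix → Matrix → Set
CornersMeet i j A C P =
    (bottomRight i j A ≡ P × topLeft i j C ≡ P)
  ⊎ (bottomRight i j C ≡ P × topLeft i j A ≡ P)
  ⊎ (bottomLeft i j A ≡ P × topRight i j C ≡ P)
  ⊎ (bottomLeft i j C ≡ P × topRight i j A ≡ P)

cornersMeet⇒fullWidth : ∀ {c c' i j a as b bs P} →
  PrimeDyckRows c (a ∷ as) → PrimeDyckRows c' (b ∷ bs) →
  0 < i → 0 < j → j ≤ length a → j ≤ length b →
  CornersMeet i j (a ∷ as) (b ∷ bs) P → j ≡ c × j ≡ c'
cornersMeet⇒fullWidth rowsA@((_ , refl) ∷ _) rowsB@((_ , refl) ∷ _) (s≤s _) 0<j j≤c j≤c' meet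
  with meet
... | inj₁ (e₁ , e₂) =
  bottomRight≡topLeft⇒fullWidth rowsA rowsB 0<j j≤c j≤c' (trans e₁ (sym e₂))
... | inj₂ (inj₁ (e₁ , e₂)) =
  swap (bottomRight≡topLeft⇒fullWidth rowsB rowsA 0<j j≤c' j≤c (trans e₁ (sym e₂)))
... | inj₂ (inj₂ (inj₁ (e₁ , e₂))) =
  bottomLeft≡topRight⇒fullWidth rowsA rowsB 0<j j≤c j≤c' (trans e₁ (sym e₂))
... | inj₂ (inj₂ (inj₂ (e₁ , e₂))) =
  swap (bottomLeft≡topRight⇒fullWidth rowsB rowsA 0<j j≤c' j≤c (trans e₁ (sym e₂)))

module _ {c : ℕ} {M : Matrix} (rect : All (λ r → length r ≡ c) M) (|M| : ncols M ≡ c) where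

  private
    ncols∸c≡0 : ncols M ∸ c ≡ 0
    ncols∸c≡0 = trans (cong (_∸ c) |M|) (n∸n≡0 c)

    map-take-c : ∀ {N : Matrix} → All (λ r → length r ≡ c) N → map (take c) N ≡ N
    map-take-c = map-id-local ∘ All.map (λ |r| → take-all c _ (≤-reflexive |r|))

  topLeft-fullWidth : ∀ i → topLeft i c M ≡ take i M
  topLeft-fullWidth i = map-take-c (take⁺ i rect)

  topRight-fullWidth : ∀ i → topRight i c M ≡ take i M
  topRight-fullWidth i rewrite ncols∸c≡0 = map-id {A = BinStr} (take i M)

  bottomLeft-fullWidth : ∀ i → bottomLeft i c M ≡ drop (nrows M ∸ i) M
  bottomLeft-fullWidth i = map-take-c (drop⁺ (nrows M ∸ i) rect)

  bottomRight-fullWidth : ∀ i → bottomRight i c M ≡ drop (nrows M ∸ i) M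
  bottomRight-fullWidth i rewrite ncols∸c≡0 = map-id {A = BinStr} (drop (nrows M ∸ i) M)

Inner : BinStr → BinStr → BinStr → Set
Inner t b r = r ≢ t × r ≢ b

fullWidth-cornersMeet : ∀ {c i A C P} →
  All (λ r → length r ≡ c) A → ncols A ≡ c → All (λ r → length r ≡ c) C → ncols C ≡ c →
  CornersMeet i c A C P →
  (drop (nrows A ∸ i) A ≡ P × take i C ≡ P) ⊎ (drop (nrows C ∸ i) C ≡ P × take i A ≡ P)
fullWidth-cornersMeet {i = i} rectA |A| rectC |C| = λ where
  (inj₁ (e₁ , e₂)) → inj₁ (trans (sym (bottomRight-fullWidth rectA |A| i)) e₁
                         , trans (sym (topLeft-fullWidth rectC |C| i)) e₂)
  (inj₂ (inj₁ (e₁ , e₂))) → inj₂ (trans (sym (bottomRight-fullWidth rectC |C| i)) e₁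
                                , trans (sym (topLeft-fullWidth rectA |A| i)) e₂)
  (inj₂ (inj₂ (inj₁ (e₁ , e₂)))) → inj₁ (trans (sym (bottomLeft-fullWidth rectA |A| i)) e₁
                                       , trans (sym (topRight-fullWidth rectC |C| i)) e₂)
  (inj₂ (inj₂ (inj₂ (e₁ , e₂)))) → inj₂ (trans (sym (bottomLeft-fullWidth rectC |C| i)) e₁
                                       , trans (sym (topRight-fullWidth rectA |A| i)) e₂)

last∈take⇒take-all : ∀ {A : Set} {b : A} {i} ys → All (_≢ b) ys →
  b ∈ take i (ys ++ [ b ]) → take i (ys ++ [ b ]) ≡ ys ++ [ b ]
last∈take⇒take-all {i = suc i} []       _          _          = cong (_ ∷_) (take-[] i)
last∈take⇒take-all {i = suc i} (y ∷ ys) (y≢b ∷ _)  (here b≡y) = ⊥-elim (y≢b (sym b≡y))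
last∈take⇒take-all {i = suc i} (y ∷ ys) (_ ∷ ys≢b) (there b∈) =
  cong (y ∷_) (last∈take⇒take-all ys ys≢b b∈)

framed : ∀ {A : Set} → A → List A → A → List A
framed t as b = t ∷ as ++ [ b ]

framed-drop≡take⇒equal : ∀ {A : Set} {t b : A} {as cs : List A} k {i} →
  t ≢ b → All (_≢ t) as → All (_≢ b) cs → 0 < i →
  drop k (framed t as b) ≡ take i (framed t cs b) →
  framed t as b ≡ framed t cs b × take i (framed t cs b) ≡ framed t cs b
framed-drop≡take⇒equal {t = t} (suc k) t≢b as≢t _ (s≤s _) eq =
  ⊥-elim (All.lookup (drop⁺ k (++⁺ as≢t (t≢b ∘ sym ∷ [])))
                     (subst (t ∈_) (sym eq) (here refl)) refl)
framed-drop≡take⇒equal {t = t} {b} {as} {cs} zero {i} t≢b _ cs≢b _ eq =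
  trans eq take-all-C , take-all-C
  where
  take-all-C : take i (framed t cs b) ≡ framed t cs b
  take-all-C = last∈take⇒take-all (t ∷ cs) (t≢b ∷ cs≢b)
                 (subst (b ∈_) eq (∈-++⁺ʳ (t ∷ as) (here refl)))

framed-cornersMeet⇒trivial : ∀ {c i} {t b : BinStr} {as cs P : Matrix} →
  All (λ r → length r ≡ c) (framed t as b) → All (λ r → length r ≡ c) (framed t cs b) →
  t ≢ b → All (Inner t b) as → All (Inner t b) cs → 0 < i →
  CornersMeet i c (framed t as b) (framed t cs b) P →
  framed t as b ≡ framed t cs b × framed t cs b ≡ P
framed-cornersMeet⇒trivial {i = i} {t} {b} {as} {cs} rectA rectC t≢b innerA innerC 0<i meet
  with fullWidth-cornersMeet rectA (All.head rectA) rectC (All.head rectC) meet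
... | inj₁ (suffix≡P , prefix≡P)
  with framed-drop≡take⇒equal {t = t} {b} (nrows (framed t as b) ∸ i) t≢b
         (All.map proj₁ innerA) (All.map proj₂ innerC) 0<i (trans suffix≡P (sym prefix≡P))
... | A≡C , take-C≡C = A≡C , trans (sym take-C≡C) prefix≡P
framed-cornersMeet⇒trivial {i = i} {t} {b} {as} {cs} rectA rectC t≢b innerA innerC 0<i meet
  | inj₂ (suffix≡P , prefix≡P)
  with framed-drop≡take⇒equal {t = t} {b} (nrows (framed t cs b) ∸ i) t≢b
         (All.map proj₁ innerC) (All.map proj₂ innerA) 0<i (trans suffix≡P (sym prefix≡P))
... | C≡A , take-A≡A = sym C≡A , trans C≡A (trans (sym take-A≡A) prefix≡P)

framedRows : ∀ {s} {t b : BinStr} {inner : Matrix} → 1 ≤ s → InR s t → InR s b →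
  All (λ r → InR s r × Inner t b r) inner → PrimeDyckRows (2 * s) (framed t inner b)
framedRows {s} 1≤s tR bR inner = row tR ∷ ++⁺ (All.map (row ∘ proj₁) inner) (row bR ∷ [])
  where
  row : ∀ {w} → InR s w → PrimeDyck w × length w ≡ 2 * s
  row wR = InR⇒PrimeDyck {s} wR , InR-length 1≤s wR

mainTheorem2 : (m n : ℕ) → 2 ≤ m → 4 ≤ n → (T B : ℕ → BinStr) →
    ValidChoice n T B → NonOverlappingSet (InD m n T B)
mainTheorem2 _ _ _ _ _ _ valid _ _
  (_ , s , _ , _ , 2≤s , s≤n/2 , twoA , as , _ , innerA , refl)
  (_ , s' , _ , _ , 2≤s' , s'≤n/2 , twoC , cs , _ , innerC , refl)
  (i , j , P , 0<i , 0<j , _ , j≤A , _ , j≤C , meet , nontrivial)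
  with valid s 2≤s s≤n/2 twoA | valid s' 2≤s' s'≤n/2 twoC
... | tR , bR , t≢b | tR' , bR' , _
  with rowsA ← framedRows (<⇒≤ 2≤s) tR bR innerA
     | rowsC ← framedRows (<⇒≤ 2≤s') tR' bR' innerC
  with cornersMeet⇒fullWidth rowsA rowsC 0<i 0<j j≤A j≤C meet
... | refl , 2s≡2s' with *-cancelˡ-≡ s s' 2 2s≡2s'
... | refl = nontrivial (framed-cornersMeet⇒trivial (All.map proj₂ rowsA) (All.map proj₂ rowsC) t≢b
                           (All.map proj₂ innerA) (All.map proj₂ innerC) 0<i meet)
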